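{- Let $a,b$ be non-commuting indeterminates and let $S$ be a formal power series in $a,b$ (in $\mathbb{Z}\langle\langle a,b\rangle\rangle$) such that $S=1+aSb$. Then the inverse of $S$ is of the form $S^{ -1}=1-C$ with $C=aDb$ for a formal power series $D$ in $a,b$, and $D$ satisfies $$D=1+D(x-ab)+DaDb,\qquad\text{where } x=ab-ba.$$ -}

module Defs where

open import Data.Bool using (Bool; true; false)
open import Data.List using (List; []; _∷_)
open import Data.Integer using (ℤ; +_; _+_; _*_; -_)
open import Relation.Binary.PropositionalEquality using (_≡_)

-- Letters of the free monoid on {a, b}: false = a, true = b.
Letter : Set
Letter = Bool

Word : Set
Word = List Letter

Series : Set
Series = Word → ℤ

infix 4 _≈_
_≈_ : Series → Series → Set
f ≈ g = ∀ w → f w ≡ g w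

𝟙 : Series
𝟙 [] = + 1
𝟙 (_ ∷ _) = + 0

𝕒 : Series
𝕒 (false ∷ []) = + 1
𝕒 _ = + 0

𝕓 : Series
𝕓 (true ∷ []) = + 1
𝕓 _ = + 0

infixl 6 _⊕_ _⊖_
infixl 7 _⊛_

_⊕_ : Series → Series → Series
(f ⊕ g) w = f w + g w

⊝_ : Series → Series
(⊝ f) w = - f w

_⊖_ : Series → Series → Series
f ⊖ g = f ⊕ (⊝ g)

-- Cauchy product: (f ⊛ g)(w) = Σ_{u v = w} f(u) g(v).
-- Recursion: splittings of x ∷ w are ([] , x ∷ w) and (x ∷ u , v) with u v = w.
_⊛_ : Series → Series → Series
(f ⊛ g) [] = f [] * g []
(f ⊛ g) (x ∷ w) = f [] * g (x ∷ w) + ((λ u → f (x ∷ u)) ⊛ g) w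

-- All series are determined by "contraction": the maps X ↦ Ψ(X) that occur
-- compute the coefficient of a word w from coefficients of X on strictly
-- shorter words.  Such a map has exactly one fixed point (existence by
-- iterating from 0, uniqueness by induction on word length).
--
-- Then, for any D with D = 1 + D(x − ab) + DaDb, put E = aD,
-- C = Eb = aDb and T = 1 − C.  Since x − ab = −ba, the equation for D gives
-- E = a − Ca + EC, i.e. the intertwining relation T a = E T.  Hence T S and 1
-- both solve X = T + E X b, so T S = 1.  Finally, any right inverse S of
-- 1 − C with C of zero constant term is also a left inverse: S T and 1 both
-- solve X = T + C X.  The theorem takes D to be the fixed point of the
-- (contractive) equation defining it.

module Submission where

open import Defs
open import Data.Product using (Σ; _×_; _,_)
open import Data.List using ([]; _∷_; length)
open import Data.Nat using (ℕ; zero; suc; _≤_; _<_; _≤′_; ≤′-refl; ≤′-step; z≤n; s≤s)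
open import Data.Nat.Properties using (≤-refl; ≤-trans; m≤n⇒m≤1+n; ≤⇒≤′; ≤′⇒≤)
open import Data.Integer using (ℤ; +_; _+_; _*_; -_)
open import Data.Integer.Properties using (*-zeroˡ; *-zeroʳ; *-assoc; *-identityˡ; *-identityʳ; +-identityˡ)
open import Data.Integer.Solver using (module +-*-Solver)
open import Relation.Binary.PropositionalEquality using (_≡_; refl; sym; trans; cong; cong₂)
open import Relation.Binary.Bundles using (Setoid)
import Relation.Binary.Reasoning.Setoid as SetoidReasoning

open +-*-Solver

shift : Letter → Series → Series
shift x f u = f (x ∷ u)

infix 4 _≈[<_]_
_≈[<_]_ : Series → ℕ → Series → Set
f ≈[< n ] g = ∀ u → length u < n → f u ≡ g u

agree-refl : ∀ {f n} → f ≈[< n ] f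
agree-refl u _ = refl

agree-trans : ∀ {f g h n} → f ≈[< n ] g → g ≈[< n ] h → f ≈[< n ] h
agree-trans p q u r = trans (p u r) (q u r)

agree-mono : ∀ {f g m n} → m ≤ n → f ≈[< n ] g → f ≈[< m ] g
agree-mono m≤n p u q = p u (≤-trans q m≤n)

⊕-agree : ∀ {f f' g g' n} → f ≈[< n ] f' → g ≈[< n ] g' → f ⊕ g ≈[< n ] f' ⊕ g'
⊕-agree p q u r = cong₂ _+_ (p u r) (q u r)

⊛-local : ∀ {f f' g g'} w → f ≈[< suc (length w) ] f' → g ≈[< suc (length w) ] g' →
          (f ⊛ g) w ≡ (f' ⊛ g') w
⊛-local [] p q = cong₂ _*_ (p [] (s≤s z≤n)) (q [] (s≤s z≤n))
⊛-local {f} {f'} (x ∷ w) p q =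
  cong₂ _+_ (cong₂ _*_ (p [] (s≤s z≤n)) (q (x ∷ w) ≤-refl))
            (⊛-local {shift x f} {shift x f'} w (λ u r → p (x ∷ u) (s≤s r))
                                                (λ v r → q v (m≤n⇒m≤1+n r)))

⊛-agree : ∀ {f f' g g' n} → f ≈[< n ] f' → g ≈[< n ] g' → f ⊛ g ≈[< n ] f' ⊛ g'
⊛-agree p q u r = ⊛-local u (agree-mono r p) (agree-mono r q)

zero-factorˡ : ∀ {a} → a ≡ + 0 → ∀ y z → a * y ≡ a * z
zero-factorˡ refl y z = trans (*-zeroˡ y) (sym (*-zeroˡ z))

zero-factorʳ : ∀ {a} → a ≡ + 0 → ∀ y z → y * a ≡ z * a
zero-factorʳ refl y z = trans (*-zeroʳ y) (sym (*-zeroʳ z))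

⊛-localˡ : ∀ {f f' G} w → G [] ≡ + 0 → f ≈[< length w ] f' → (f ⊛ G) w ≡ (f' ⊛ G) w
⊛-localˡ {f} {f'} [] G₀ _ = zero-factorʳ G₀ (f []) (f' [])
⊛-localˡ {f} {f'} (x ∷ w) G₀ p =
  cong₂ _+_ (cong (_* _) (p [] (s≤s z≤n)))
            (⊛-localˡ {shift x f} {shift x f'} w G₀ (λ u r → p (x ∷ u) (s≤s r)))

⊛-localʳ : ∀ {F g g'} w → F [] ≡ + 0 → g ≈[< length w ] g' → (F ⊛ g) w ≡ (F ⊛ g') w
⊛-localʳ {F} {g} {g'} [] F₀ _ = zero-factorˡ F₀ (g []) (g' [])
⊛-localʳ {F} {g} {g'} (x ∷ w) F₀ p =
  cong₂ _+_ (zero-factorˡ F₀ (g (x ∷ w)) (g' (x ∷ w)))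
            (⊛-local {shift x F} {shift x F} w agree-refl p)

⊛-agreeˡ-suc : ∀ {f f' G n} → G [] ≡ + 0 → f ≈[< n ] f' → f ⊛ G ≈[< suc n ] f' ⊛ G
⊛-agreeˡ-suc G₀ p u (s≤s r) = ⊛-localˡ u G₀ (agree-mono r p)

⊛-agreeʳ-suc : ∀ {F g g' n} → F [] ≡ + 0 → g ≈[< n ] g' → F ⊛ g ≈[< suc n ] F ⊛ g'
⊛-agreeʳ-suc F₀ p u (s≤s r) = ⊛-localʳ u F₀ (agree-mono r p)

Contractive : (Series → Series) → Set
Contractive Ψ = ∀ {n X Y} → X ≈[< n ] Y → Ψ X ≈[< suc n ] Ψ Y

fixed-point-unique : ∀ {Ψ X Y} → Contractive Ψ → X ≈ Ψ X → Y ≈ Ψ Y → X ≈ Y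
fixed-point-unique {Ψ} {X} {Y} contr X-fix Y-fix w = agree-below (suc (length w)) w ≤-refl
  where
  agree-below : ∀ n → X ≈[< n ] Y
  agree-below zero u ()
  agree-below (suc n) u r = trans (X-fix u) (trans (contr (agree-below n) u r) (sym (Y-fix u)))

-- A contractive map has a fixed point: the iterates Ψⁿ(0) stabilise below
-- length n, and the fixed point reads off the coefficient of w from Ψ^{|w|+1}(0).
module FixedPoint (Ψ : Series → Series) (contr : Contractive Ψ) where

  approx : ℕ → Series
  approx zero    = λ _ → + 0
  approx (suc n) = Ψ (approx n)

  approx-step : ∀ n → approx n ≈[< n ] approx (suc n)
  approx-step zero u ()
  approx-step (suc n) = contr (approx-step n)

  approx-stable : ∀ {m n} → m ≤′ n → approx m ≈[< m ] approx n
  approx-stable ≤′-refl = agree-refl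
  approx-stable (≤′-step {n} m≤′n) =
    agree-trans (approx-stable m≤′n) (agree-mono (≤′⇒≤ m≤′n) (approx-step n))

  limit : Series
  limit w = approx (suc (length w)) w

  limit-fixed : limit ≈ Ψ limit
  limit-fixed w = contr {length w} {approx (length w)} {limit}
    (λ u r → sym (approx-stable (≤⇒≤′ r) u ≤-refl)) w ≤-refl

fixed-point : ∀ {Ψ} → Contractive Ψ → Σ Series (λ X → X ≈ Ψ X)
fixed-point {Ψ} contr = limit , limit-fixed
  where open FixedPoint Ψ contr

series-setoid : Setoid _ _
series-setoid = record
  { Carrier = Series ; _≈_ = _≈_
  ; isEquivalence = record { refl = λ _ → refl ; sym = λ p w → sym (p w) ; trans = λ p q w → trans (p w) (q w) } }

open SetoidReasoning series-setoid

≈-sym : ∀ {f g} → f ≈ g → g ≈ f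
≈-sym p w = sym (p w)

⊕-congˡ : ∀ {f f'} → f ≈ f' → ∀ g → f ⊕ g ≈ f' ⊕ g
⊕-congˡ p g w = cong (_+ g w) (p w)

⊕-congʳ : ∀ f {g g'} → g ≈ g' → f ⊕ g ≈ f ⊕ g'
⊕-congʳ f q w = cong (_+_ (f w)) (q w)

⊝-cong : ∀ {f f'} → f ≈ f' → ⊝ f ≈ ⊝ f'
⊝-cong p w = cong -_ (p w)

⊛-congˡ : ∀ {f f'} → f ≈ f' → ∀ g → f ⊛ g ≈ f' ⊛ g
⊛-congˡ p g w = ⊛-local w (λ u _ → p u) agree-refl

⊛-congʳ : ∀ f {g g'} → g ≈ g' → f ⊛ g ≈ f ⊛ g'
⊛-congʳ f q w = ⊛-local w agree-refl (λ v _ → q v)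

⊖-⊕-cancel : ∀ f g → f ⊖ g ⊕ g ≈ f
⊖-⊕-cancel f g w = solve 2 (λ a b → (a :+ :- b) :+ b := a) refl (f w) (g w)

⊕-⊖-cancel : ∀ f g → f ⊕ g ⊖ g ≈ f
⊕-⊖-cancel f g w = solve 2 (λ a b → (a :+ b) :+ :- b := a) refl (f w) (g w)

interchange : ∀ a b c d → (a + b) + (c + d) ≡ (a + c) + (b + d)
interchange = solve 4 (λ a b c d → (a :+ b) :+ (c :+ d) := (a :+ c) :+ (b :+ d)) refl

⊛-distribˡ : ∀ f g h → f ⊛ (g ⊕ h) ≈ f ⊛ g ⊕ f ⊛ h
⊛-distribˡ f g h [] = solve 3 (λ a b c → a :* (b :+ c) := a :* b :+ a :* c) refl (f []) (g []) (h [])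
⊛-distribˡ f g h (x ∷ w) =
  trans (cong₂ _+_ (solve 3 (λ a b c → a :* (b :+ c) := a :* b :+ a :* c) refl (f []) (g (x ∷ w)) (h (x ∷ w)))
                   (⊛-distribˡ (shift x f) g h w))
        (interchange (f [] * g (x ∷ w)) (f [] * h (x ∷ w)) ((shift x f ⊛ g) w) ((shift x f ⊛ h) w))

⊛-distribʳ : ∀ f g h → (f ⊕ g) ⊛ h ≈ f ⊛ h ⊕ g ⊛ h
⊛-distribʳ f g h [] = solve 3 (λ a b c → (a :+ b) :* c := a :* c :+ b :* c) refl (f []) (g []) (h [])
⊛-distribʳ f g h (x ∷ w) =
  trans (cong₂ _+_ (solve 3 (λ a b c → (a :+ b) :* c := a :* c :+ b :* c) refl (f []) (g []) (h (x ∷ w)))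
                   (⊛-distribʳ (shift x f) (shift x g) h w))
        (interchange (f [] * h (x ∷ w)) (g [] * h (x ∷ w)) ((shift x f ⊛ h) w) ((shift x g ⊛ h) w))

⊛-negʳ : ∀ f g → f ⊛ (⊝ g) ≈ ⊝ (f ⊛ g)
⊛-negʳ f g [] = solve 2 (λ a b → a :* (:- b) := :- (a :* b)) refl (f []) (g [])
⊛-negʳ f g (x ∷ w) =
  trans (cong (_+_ (f [] * - g (x ∷ w))) (⊛-negʳ (shift x f) g w))
        (solve 3 (λ a b c → a :* (:- b) :+ (:- c) := :- (a :* b :+ c)) refl (f []) (g (x ∷ w)) ((shift x f ⊛ g) w))

⊛-negˡ : ∀ f g → (⊝ f) ⊛ g ≈ ⊝ (f ⊛ g)
⊛-negˡ f g [] = solve 2 (λ a b → (:- a) :* b := :- (a :* b)) refl (f []) (g [])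
⊛-negˡ f g (x ∷ w) =
  trans (cong (_+_ ((- f []) * g (x ∷ w))) (⊛-negˡ (shift x f) g w))
        (solve 3 (λ a b c → (:- a) :* b :+ (:- c) := :- (a :* b :+ c)) refl (f []) (g (x ∷ w)) ((shift x f ⊛ g) w))

-- The zero series is a left annihilator (it arises as shift x 𝟙).
⊛-zeroˡ : ∀ f w → ((λ _ → + 0) ⊛ f) w ≡ + 0
⊛-zeroˡ f [] = *-zeroˡ (f [])
⊛-zeroˡ f (x ∷ w) = cong₂ _+_ (*-zeroˡ (f (x ∷ w))) (⊛-zeroˡ f w)

⊛-identityˡ : ∀ f → 𝟙 ⊛ f ≈ f
⊛-identityˡ f [] = *-identityˡ (f [])
⊛-identityˡ f (x ∷ w) =
  trans (cong₂ _+_ (*-identityˡ (f (x ∷ w))) (⊛-zeroˡ f w)) (solve 1 (λ a → a :+ con (+ 0) := a) refl (f (x ∷ w)))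

⊛-identityʳ : ∀ f → f ⊛ 𝟙 ≈ f
⊛-identityʳ f [] = *-identityʳ (f [])
⊛-identityʳ f (x ∷ w) = trans (cong₂ _+_ (*-zeroʳ (f [])) (⊛-identityʳ (shift x f) w)) (+-identityˡ _)

-- Scalar multiple of a series; needed because shift x (f ⊛ g) = f([])·shift x g + shift x f ⊛ g.
_·_ : ℤ → Series → Series
(c · g) u = c * g u

⊛-scalarˡ : ∀ c g h → (c · g) ⊛ h ≈ c · (g ⊛ h)
⊛-scalarˡ c g h [] = *-assoc c (g []) (h [])
⊛-scalarˡ c g h (x ∷ w) =
  trans (cong (_+_ ((c * g []) * h (x ∷ w))) (⊛-scalarˡ c (shift x g) h w))
        (solve 4 (λ c a b r → (c :* a) :* b :+ c :* r := c :* (a :* b :+ r)) refl c (g []) (h (x ∷ w)) ((shift x g ⊛ h) w))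

⊛-assoc : ∀ f g h → (f ⊛ g) ⊛ h ≈ f ⊛ (g ⊛ h)
⊛-assoc f g h [] = *-assoc (f []) (g []) (h [])
⊛-assoc f g h (x ∷ w) =
  trans (cong (_+_ ((f [] * g []) * h (x ∷ w)))
              (trans (⊛-distribʳ (f [] · shift x g) (shift x f ⊛ g) h w)
                     (cong₂ _+_ (⊛-scalarˡ (f []) (shift x g) h w) (⊛-assoc (shift x f) g h w))))
        (solve 5 (λ f₀ g₀ hx s r → (f₀ :* g₀) :* hx :+ (f₀ :* s :+ r) := f₀ :* (g₀ :* hx :+ s) :+ r) refl
               (f []) (g []) (h (x ∷ w)) ((shift x g ⊛ h) w) ((shift x f ⊛ (g ⊛ h)) w))

-- A series 1 − C with C of zero constant term: any right inverse S is also a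
-- left inverse, since S(1 − C) and 1 both solve the contractive X = (1 − C) + C X.
right-inverse⇒left-inverse : ∀ C S → C [] ≡ + 0 → (𝟙 ⊖ C) ⊛ S ≈ 𝟙 → S ⊛ (𝟙 ⊖ C) ≈ 𝟙
right-inverse⇒left-inverse C S C₀ right-inv =
  fixed-point-unique contractive ST-solves 1-solves
  where
  T W : Series
  T = 𝟙 ⊖ C
  W = S ⊛ T

  contractive : Contractive (λ X → T ⊕ C ⊛ X)
  contractive p = ⊕-agree (agree-refl {T}) (⊛-agreeʳ-suc {C} C₀ p)

  W-minus-CW : W ⊖ C ⊛ W ≈ T
  W-minus-CW = begin
    W ⊕ ⊝ (C ⊛ W)          ≈⟨ ≈-sym (⊕-congˡ (⊛-identityˡ W) _) ⟩
    𝟙 ⊛ W ⊕ ⊝ (C ⊛ W)      ≈⟨ ≈-sym (⊕-congʳ (𝟙 ⊛ W) (⊛-negˡ C W)) ⟩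
    𝟙 ⊛ W ⊕ (⊝ C) ⊛ W      ≈⟨ ≈-sym (⊛-distribʳ 𝟙 (⊝ C) W) ⟩
    T ⊛ (S ⊛ T)            ≈⟨ ≈-sym (⊛-assoc T S T) ⟩
    (T ⊛ S) ⊛ T            ≈⟨ ⊛-congˡ right-inv T ⟩
    𝟙 ⊛ T                  ≈⟨ ⊛-identityˡ T ⟩
    T                      ∎

  ST-solves : W ≈ T ⊕ C ⊛ W
  ST-solves = begin
    W                      ≈⟨ ≈-sym (⊖-⊕-cancel W (C ⊛ W)) ⟩
    W ⊖ C ⊛ W ⊕ C ⊛ W      ≈⟨ ⊕-congˡ W-minus-CW (C ⊛ W) ⟩
    T ⊕ C ⊛ W              ∎

  1-solves : 𝟙 ≈ T ⊕ C ⊛ 𝟙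
  1-solves = ≈-sym (begin
    T ⊕ C ⊛ 𝟙              ≈⟨ ⊕-congʳ T (⊛-identityʳ C) ⟩
    T ⊕ C                  ≈⟨ ⊖-⊕-cancel 𝟙 C ⟩
    𝟙                      ∎)

𝕩 : Series
𝕩 = 𝕒 ⊛ 𝕓 ⊖ 𝕓 ⊛ 𝕒

Φ : Series → Series
Φ X = 𝟙 ⊕ X ⊛ (𝕩 ⊖ 𝕒 ⊛ 𝕓) ⊕ X ⊛ 𝕒 ⊛ X ⊛ 𝕓

x-minus-ab : 𝕩 ⊖ 𝕒 ⊛ 𝕓 ≈ ⊝ (𝕓 ⊛ 𝕒)
x-minus-ab w = solve 2 (λ p q → (p :+ :- q) :+ :- p := :- q) refl ((𝕒 ⊛ 𝕓) w) ((𝕓 ⊛ 𝕒) w)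

-- Both products in Φ(X) end in a factor without constant term, so Φ is contractive.
Φ-contractive : Contractive Φ
Φ-contractive p =
  ⊕-agree (⊕-agree (agree-refl {𝟙}) (⊛-agreeˡ-suc {G = 𝕩 ⊖ 𝕒 ⊛ 𝕓} refl p))
          (⊛-agreeˡ-suc {G = 𝕓} refl (⊛-agree (⊛-agree p (agree-refl {𝕒})) p))

module Solution (D : Series) (D-eq : D ≈ Φ D) where

  E C T : Series
  E = 𝕒 ⊛ D
  C = E ⊛ 𝕓
  T = 𝟙 ⊖ C

  E₀ : E [] ≡ + 0
  E₀ = *-zeroˡ (D [])

  C₀ : C [] ≡ + 0
  C₀ = *-zeroʳ (E [])

  -- Left-multiplying the equation for D by a:  aD = a − aDba + aD·aDb.
  E-eq : E ≈ 𝕒 ⊖ C ⊛ 𝕒 ⊕ E ⊛ C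
  E-eq = begin
    𝕒 ⊛ D                                      ≈⟨ ⊛-congʳ 𝕒 D-eq ⟩
    𝕒 ⊛ (𝟙 ⊕ D ⊛ P ⊕ D ⊛ 𝕒 ⊛ D ⊛ 𝕓)            ≈⟨ ⊛-distribˡ 𝕒 _ _ ⟩
    𝕒 ⊛ (𝟙 ⊕ D ⊛ P) ⊕ 𝕒 ⊛ (D ⊛ 𝕒 ⊛ D ⊛ 𝕓)      ≈⟨ ⊕-congˡ (⊛-distribˡ 𝕒 𝟙 (D ⊛ P)) _ ⟩
    𝕒 ⊛ 𝟙 ⊕ 𝕒 ⊛ (D ⊛ P) ⊕ 𝕒 ⊛ (D ⊛ 𝕒 ⊛ D ⊛ 𝕓) ≈⟨ ⊕-congˡ (⊕-congˡ (⊛-identityʳ 𝕒) _) _ ⟩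
    𝕒 ⊕ 𝕒 ⊛ (D ⊛ P) ⊕ 𝕒 ⊛ (D ⊛ 𝕒 ⊛ D ⊛ 𝕓)      ≈⟨ ⊕-congˡ (⊕-congʳ 𝕒 linear-term) _ ⟩
    𝕒 ⊖ C ⊛ 𝕒 ⊕ 𝕒 ⊛ (D ⊛ 𝕒 ⊛ D ⊛ 𝕓)           ≈⟨ ⊕-congʳ (𝕒 ⊖ C ⊛ 𝕒) quadratic-term ⟩
    𝕒 ⊖ C ⊛ 𝕒 ⊕ E ⊛ C                          ∎
    where
    P : Series
    P = 𝕩 ⊖ 𝕒 ⊛ 𝕓

    linear-term : 𝕒 ⊛ (D ⊛ P) ≈ ⊝ (C ⊛ 𝕒)
    linear-term = begin
      𝕒 ⊛ (D ⊛ P)        ≈⟨ ≈-sym (⊛-assoc 𝕒 D P) ⟩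
      E ⊛ P              ≈⟨ ⊛-congʳ E x-minus-ab ⟩
      E ⊛ ⊝ (𝕓 ⊛ 𝕒)      ≈⟨ ⊛-negʳ E (𝕓 ⊛ 𝕒) ⟩
      ⊝ (E ⊛ (𝕓 ⊛ 𝕒))    ≈⟨ ⊝-cong (≈-sym (⊛-assoc E 𝕓 𝕒)) ⟩
      ⊝ (C ⊛ 𝕒)          ∎

    quadratic-term : 𝕒 ⊛ (D ⊛ 𝕒 ⊛ D ⊛ 𝕓) ≈ E ⊛ C
    quadratic-term = begin
      𝕒 ⊛ (D ⊛ 𝕒 ⊛ D ⊛ 𝕓)      ≈⟨ ≈-sym (⊛-assoc 𝕒 _ 𝕓) ⟩
      𝕒 ⊛ (D ⊛ 𝕒 ⊛ D) ⊛ 𝕓      ≈⟨ ⊛-congˡ (≈-sym (⊛-assoc 𝕒 (D ⊛ 𝕒) D)) 𝕓 ⟩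
      𝕒 ⊛ (D ⊛ 𝕒) ⊛ D ⊛ 𝕓      ≈⟨ ⊛-congˡ (⊛-congˡ (≈-sym (⊛-assoc 𝕒 D 𝕒)) D) 𝕓 ⟩
      E ⊛ 𝕒 ⊛ D ⊛ 𝕓            ≈⟨ ⊛-congˡ (⊛-assoc E 𝕒 D) 𝕓 ⟩
      E ⊛ E ⊛ 𝕓                ≈⟨ ⊛-assoc E E 𝕓 ⟩
      E ⊛ C                    ∎

  T-intertwines : T ⊛ 𝕒 ≈ E ⊛ T
  T-intertwines = begin
    T ⊛ 𝕒                         ≈⟨ ⊛-distribʳ 𝟙 (⊝ C) 𝕒 ⟩
    𝟙 ⊛ 𝕒 ⊕ (⊝ C) ⊛ 𝕒             ≈⟨ ⊕-congˡ (⊛-identityˡ 𝕒) _ ⟩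
    𝕒 ⊕ (⊝ C) ⊛ 𝕒                 ≈⟨ ⊕-congʳ 𝕒 (⊛-negˡ C 𝕒) ⟩
    𝕒 ⊖ C ⊛ 𝕒                     ≈⟨ ≈-sym (⊕-⊖-cancel (𝕒 ⊖ C ⊛ 𝕒) (E ⊛ C)) ⟩
    𝕒 ⊖ C ⊛ 𝕒 ⊕ E ⊛ C ⊖ E ⊛ C     ≈⟨ ⊕-congˡ (≈-sym E-eq) _ ⟩
    E ⊖ E ⊛ C                     ≈⟨ ≈-sym (⊕-congˡ (⊛-identityʳ E) _) ⟩
    E ⊛ 𝟙 ⊖ E ⊛ C                 ≈⟨ ≈-sym (⊕-congʳ (E ⊛ 𝟙) (⊛-negʳ E C)) ⟩
    E ⊛ 𝟙 ⊕ E ⊛ ⊝ C               ≈⟨ ≈-sym (⊛-distribˡ E 𝟙 (⊝ C)) ⟩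
    E ⊛ T                         ∎

  -- T is a left inverse of S: T S and 1 both solve the contractive X = T + E X b.
  T-left-inverse : ∀ S → S ≈ 𝟙 ⊕ 𝕒 ⊛ S ⊛ 𝕓 → T ⊛ S ≈ 𝟙
  T-left-inverse S S-eq = fixed-point-unique contractive TS-solves 1-solves
    where
    contractive : Contractive (λ X → T ⊕ E ⊛ (X ⊛ 𝕓))
    contractive p = ⊕-agree (agree-refl {T}) (⊛-agreeʳ-suc {E} E₀ (⊛-agree p (agree-refl {𝕓})))

    TS-solves : T ⊛ S ≈ T ⊕ E ⊛ (T ⊛ S ⊛ 𝕓)
    TS-solves = begin
      T ⊛ S                     ≈⟨ ⊛-congʳ T S-eq ⟩
      T ⊛ (𝟙 ⊕ 𝕒 ⊛ S ⊛ 𝕓)       ≈⟨ ⊛-distribˡ T 𝟙 _ ⟩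
      T ⊛ 𝟙 ⊕ T ⊛ (𝕒 ⊛ S ⊛ 𝕓)   ≈⟨ ⊕-congˡ (⊛-identityʳ T) _ ⟩
      T ⊕ T ⊛ (𝕒 ⊛ S ⊛ 𝕓)       ≈⟨ ⊕-congʳ T (≈-sym (⊛-assoc T _ 𝕓)) ⟩
      T ⊕ T ⊛ (𝕒 ⊛ S) ⊛ 𝕓       ≈⟨ ⊕-congʳ T (⊛-congˡ (≈-sym (⊛-assoc T 𝕒 S)) 𝕓) ⟩
      T ⊕ T ⊛ 𝕒 ⊛ S ⊛ 𝕓         ≈⟨ ⊕-congʳ T (⊛-congˡ (⊛-congˡ T-intertwines S) 𝕓) ⟩
      T ⊕ E ⊛ T ⊛ S ⊛ 𝕓         ≈⟨ ⊕-congʳ T (⊛-congˡ (⊛-assoc E T S) 𝕓) ⟩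
      T ⊕ E ⊛ (T ⊛ S) ⊛ 𝕓       ≈⟨ ⊕-congʳ T (⊛-assoc E _ 𝕓) ⟩
      T ⊕ E ⊛ (T ⊛ S ⊛ 𝕓)       ∎

    1-solves : 𝟙 ≈ T ⊕ E ⊛ (𝟙 ⊛ 𝕓)
    1-solves = ≈-sym (begin
      T ⊕ E ⊛ (𝟙 ⊛ 𝕓)   ≈⟨ ⊕-congʳ T (⊛-congʳ E (⊛-identityˡ 𝕓)) ⟩
      T ⊕ C             ≈⟨ ⊖-⊕-cancel 𝟙 C ⟩
      𝟙                 ∎)

  T-inverse : ∀ S → S ≈ 𝟙 ⊕ 𝕒 ⊛ S ⊛ 𝕓 → (S ⊛ T ≈ 𝟙) × (T ⊛ S ≈ 𝟙)
  T-inverse S S-eq = right-inverse⇒left-inverse C S C₀ left-inv , left-inv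
    where
    left-inv : T ⊛ S ≈ 𝟙
    left-inv = T-left-inverse S S-eq

lemma2 : (S : Series) → S ≈ 𝟙 ⊕ 𝕒 ⊛ S ⊛ 𝕓 →
    Σ Series (λ D →
      ((S ⊛ (𝟙 ⊖ 𝕒 ⊛ D ⊛ 𝕓) ≈ 𝟙) × ((𝟙 ⊖ 𝕒 ⊛ D ⊛ 𝕓) ⊛ S ≈ 𝟙))
      × (D ≈ 𝟙 ⊕ D ⊛ ((𝕒 ⊛ 𝕓 ⊖ 𝕓 ⊛ 𝕒) ⊖ 𝕒 ⊛ 𝕓) ⊕ D ⊛ 𝕒 ⊛ D ⊛ 𝕓))
lemma2 S S-eq with fixed-point Φ-contractive
... | D , D-eq = D , Solution.T-inverse D D-eq S S-eq , D-eq
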